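{- Let $(L,\vee,\wedge,0,1)$ be a bounded lattice with pseudocomplementation ${^*}$. If ${\sim}_1$ and ${\sim}_2$ are unary operations on $L$ such that both $(L,\vee,\wedge,{\sim}_1,{^*},0,1)$ and $(L,\vee,\wedge,{\sim}_2,{^*},0,1)$ are regular pseudocomplemented Kleene algebras satisfying $x^*\vee x^{**}=1$, then ${\sim}_1={\sim}_2$. That is, in a regular pseudocomplemented Kleene algebra satisfying $x^*\vee x^{**}=1$ the operation ${\sim}$ is unique.
   Context: A pseudocomplemented Kleene algebra is an algebra $(L,\vee,\wedge,{\sim},{^*},0,1)$ such that $(L,\vee,\wedge,0,1)$ is a bounded distributive lattice, ${\sim}{\sim}x=x$, $x\leq y\Rightarrow{\sim}x\geq{\sim}y$, $x\wedge{\sim}x\leq y\vee{\sim}y$, and ${^*}$ is the pseudocomplement ($x\wedge z=0$ iff $z\leq x^*$); it is regular if $x^*=y^*$ and $({\sim}x)^*=({\sim}y)^*$ imply $x=y$. -}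

module Defs where

open import Level using (_⊔_)
open import Data.Product using (_×_)
open import Algebra.Lattice.Bundles using (Lattice)

module _ {c ℓ} (L : Lattice c ℓ) where
  open Lattice L

  _≤_ : Carrier → Carrier → Set ℓ
  x ≤ y = (x ∧ y) ≈ x

  IsBounded : Carrier → Carrier → Set (c ⊔ ℓ)
  IsBounded 0# 1# = ∀ x → (0# ≤ x) × (x ≤ 1#)

  IsPseudocomplement : Carrier → (Carrier → Carrier) → Set (c ⊔ ℓ)
  IsPseudocomplement 0# _* = ∀ x z → (((x ∧ z) ≈ 0# → z ≤ (x *)) × (z ≤ (x *) → (x ∧ z) ≈ 0#))

  Distributive : Set (c ⊔ ℓ)
  Distributive = ∀ x y z → (x ∧ (y ∨ z)) ≈ ((x ∧ y) ∨ (x ∧ z))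

  -- (L, ∨, ∧, ~, *, 0, 1) is a pseudocomplemented Kleene algebra
  -- (given that (L,∨,∧,0,1) is bounded and * is the pseudocomplement)
  IsPKA : (Carrier → Carrier) → Set (c ⊔ ℓ)
  IsPKA ~_ =
    Distributive
    × (∀ x y → x ≈ y → (~ x) ≈ (~ y))
    × (∀ x → (~ (~ x)) ≈ x)
    × (∀ x y → x ≤ y → (~ y) ≤ (~ x))
    × (∀ x y → (x ∧ (~ x)) ≤ (y ∨ (~ y)))

  IsRegular : (Carrier → Carrier) → (Carrier → Carrier) → Set (c ⊔ ℓ)
  IsRegular ~_ _* = ∀ x y → (x *) ≈ (y *) → ((~ x) *) ≈ ((~ y) *) → x ≈ y

  StoneIdentity : Carrier → (Carrier → Carrier) → Set (c ⊔ ℓ)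
  StoneIdentity 1# _* = ∀ x → ((x *) ∨ ((x *) *)) ≈ 1#

-- Fix a bounded lattice with pseudocomplement *, and call b complemented when
-- b ∨ b* = 1.  For any pseudocomplemented Kleene negation ~ on it we show:
--   (1) x* ≤ ~x, hence (~y)* ≤ ~~y = y;
--   (2) every complemented b ≤ y satisfies b ≤ (~y)*.
-- So (~y)* lies below y and dominates every complemented element below y.
-- Under the Stone identity (~y)* is itself complemented, hence it is the
-- greatest complemented element below y — a description that does not
-- mention ~.  Therefore two such negations ~₁, ~₂ satisfy (~₁y)* = (~₂y)*
-- for all y.  Applying this at y = x and y = ~₂x (and using ~₁~₁x = x =
-- ~₂~₂x) gives (~₁x)* = (~₂x)* and (~₁~₁x)* = (~₁~₂x)*; regularity of ~₁
-- then yields ~₁x = ~₂x.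

module Submission where

open import Defs
open import Data.Product using (proj₁; proj₂)
open import Algebra.Lattice.Bundles using (Lattice)
import Algebra.Lattice.Properties.Lattice as LatticeProperties
import Relation.Binary.Lattice as OrderLattice
open import Relation.Binary.Bundles using (Poset)
import Relation.Binary.Reasoning.PartialOrder as PosetReasoning
import Relation.Binary.Reasoning.Setoid as SetoidReasoning

module BoundedPseudocomplemented {c ℓ} (L : Lattice c ℓ) (0# 1# : Lattice.Carrier L)
    (_* : Lattice.Carrier L → Lattice.Carrier L)
    (bounded : IsBounded L 0# 1#) (pseudocomplement : IsPseudocomplement L 0# _*) where

  open Lattice L
  open OrderLattice.Lattice (LatticeProperties.∨-∧-orderTheoreticLattice L)
    using (poset; x≤x∨y; y≤x∨y; ∨-least; x∧y≤x; x∧y≤y; ∧-greatest)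
    renaming (_≤_ to _⊑_)
  open Poset poset using ()
    renaming (refl to ⊑-refl; trans to ⊑-trans; antisym to ⊑-antisym; reflexive to ⊑-reflexive)
  open PosetReasoning poset

  -- The order of Defs (x ∧ y = x) and the library's (x = x ∧ y) agree.
  fromMeet : ∀ {x y} → _≤_ L x y → x ⊑ y
  fromMeet = sym

  toMeet : ∀ {x y} → x ⊑ y → _≤_ L x y
  toMeet = sym

  0⊑ : ∀ x → 0# ⊑ x
  0⊑ x = fromMeet (proj₁ (bounded x))

  ⊑1 : ∀ x → x ⊑ 1#
  ⊑1 x = fromMeet (proj₂ (bounded x))

  ⊑0⇒≈0 : ∀ {x} → x ⊑ 0# → x ≈ 0#
  ⊑0⇒≈0 p = ⊑-antisym p (0⊑ _)

  1⊑⇒≈1 : ∀ {x} → 1# ⊑ x → x ≈ 1#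
  1⊑⇒≈1 p = ⊑-antisym (⊑1 _) p

  *-greatest : ∀ {x z} → (x ∧ z) ≈ 0# → z ⊑ (x *)
  *-greatest {x} {z} e = fromMeet (proj₁ (pseudocomplement x z) e)

  x∧x*≈0 : ∀ x → (x ∧ (x *)) ≈ 0#
  x∧x*≈0 x = proj₂ (pseudocomplement x (x *)) (toMeet ⊑-refl)

  x⊑x** : ∀ x → x ⊑ ((x *) *)
  x⊑x** x = *-greatest (trans (∧-comm _ _) (x∧x*≈0 x))

  -- The pseudocomplement is uniquely determined, so it respects equality.
  *-cong : ∀ {x y} → x ≈ y → (x *) ≈ (y *)
  *-cong e = ⊑-antisym (⊑* e) (⊑* (sym e))
    where
    ⊑* : ∀ {x y} → x ≈ y → (x *) ⊑ (y *)
    ⊑* {x} e = *-greatest (trans (∧-cong (sym e) refl) (x∧x*≈0 x))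

  Complemented : Carrier → Set ℓ
  Complemented b = (b ∨ (b *)) ≈ 1#

  module KleeneNegation (~_ : Carrier → Carrier) (pka : IsPKA L ~_) where

    distrib : Distributive L
    distrib = proj₁ pka

    ~-cong : ∀ {x y} → x ≈ y → (~ x) ≈ (~ y)
    ~-cong = proj₁ (proj₂ pka) _ _

    ~~x≈x : ∀ x → (~ (~ x)) ≈ x
    ~~x≈x = proj₁ (proj₂ (proj₂ pka))

    ~-antitone : ∀ {x y} → x ⊑ y → (~ y) ⊑ (~ x)
    ~-antitone p = fromMeet (proj₁ (proj₂ (proj₂ (proj₂ pka))) _ _ (toMeet p))

    kleene : ∀ x y → (x ∧ (~ x)) ⊑ (y ∨ (~ y))
    kleene x y = fromMeet (proj₂ (proj₂ (proj₂ (proj₂ pka))) x y)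

    -- ~ is an order-reversing involution, hence a Galois connection with itself.
    ⊑~-swap : ∀ {x y} → x ⊑ (~ y) → y ⊑ (~ x)
    ⊑~-swap {x} {y} p = ⊑-trans (⊑-reflexive (sym (~~x≈x y))) (~-antitone p)

    ~⊑-swap : ∀ {x y} → (~ x) ⊑ y → (~ y) ⊑ x
    ~⊑-swap {x} {y} p = ⊑-trans (~-antitone p) (⊑-reflexive (~~x≈x x))

    ~0≈1 : (~ 0#) ≈ 1#
    ~0≈1 = 1⊑⇒≈1 (⊑~-swap (0⊑ (~ 1#)))

    ~1≈0 : (~ 1#) ≈ 0#
    ~1≈0 = trans (~-cong (sym ~0≈1)) (~~x≈x 0#)

    disjoint⇒~-cover : ∀ {a b} → (a ∧ b) ≈ 0# → ((~ a) ∨ (~ b)) ≈ 1#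
    disjoint⇒~-cover {a} {b} e = 1⊑⇒≈1 (begin
      1#                      ≈⟨ sym ~0≈1 ⟩
      ~ 0#                    ≈⟨ ~-cong (sym e) ⟩
      ~ (a ∧ b)               ≤⟨ ~-antitone (∧-greatest (~⊑-swap (x≤x∨y _ _)) (~⊑-swap (y≤x∨y _ _))) ⟩
      ~ (~ ((~ a) ∨ (~ b)))   ≈⟨ ~~x≈x _ ⟩
      (~ a) ∨ (~ b)           ∎)

    cover⇒~-disjoint : ∀ {a b} → (a ∨ b) ≈ 1# → ((~ a) ∧ (~ b)) ≈ 0#
    cover⇒~-disjoint {a} {b} e = ⊑0⇒≈0 (begin
      (~ a) ∧ (~ b)           ≈⟨ sym (~~x≈x _) ⟩
      ~ (~ ((~ a) ∧ (~ b)))   ≤⟨ ~-antitone (∨-least (⊑~-swap (x∧y≤x _ _)) (⊑~-swap (x∧y≤y _ _))) ⟩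
      ~ (a ∨ b)               ≈⟨ ~-cong e ⟩
      ~ 1#                    ≈⟨ ~1≈0 ⟩
      0#                      ∎)

    ∧-∨-least : ∀ {a b c d} → (a ∧ b) ⊑ d → (a ∧ c) ⊑ d → (a ∧ (b ∨ c)) ⊑ d
    ∧-∨-least {a} {b} {c} {d} p q = begin
      a ∧ (b ∨ c)             ≈⟨ distrib a b c ⟩
      (a ∧ b) ∨ (a ∧ c)       ≤⟨ ∨-least p q ⟩
      d                       ∎

    x*⊑~x : ∀ x → (x *) ⊑ (~ x)
    x*⊑~x x = begin
      x *                         ≈⟨ sym (proj₂ (bounded (x *))) ⟩
      (x *) ∧ 1#                  ≈⟨ ∧-cong refl (sym (disjoint⇒~-cover (x∧x*≈0 x))) ⟩
      (x *) ∧ ((~ x) ∨ (~ (x *))) ≤⟨ ∧-∨-least (x∧y≤y _ _) x*∧~x*⊑~x ⟩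
      ~ x                         ∎
      where
      -- x* ∧ ~x* ≤ x* ∧ (x ∨ ~x) by the Kleene inequality, and x* ∧ x = 0.
      x*∧~x*⊑~x : ((x *) ∧ (~ (x *))) ⊑ (~ x)
      x*∧~x*⊑~x = begin
        (x *) ∧ (~ (x *))   ≤⟨ ∧-greatest (x∧y≤x _ _) (kleene (x *) x) ⟩
        (x *) ∧ (x ∨ (~ x)) ≤⟨ ∧-∨-least (⊑-trans (⊑-reflexive (trans (∧-comm _ _) (x∧x*≈0 x))) (0⊑ _))
                                        (x∧y≤y _ _) ⟩
        ~ x                 ∎

    ~y*⊑y : ∀ y → ((~ y) *) ⊑ y
    ~y*⊑y y = ⊑-trans (x*⊑~x (~ y)) (⊑-reflexive (~~x≈x y))

    -- (2) (~y)* dominates every complemented element below y: such b is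
    -- disjoint from ~y because ~y ∧ b ≤ ~b ∧ ~b* = 0.
    complemented⊑~y* : ∀ {b y} → Complemented b → b ⊑ y → b ⊑ ((~ y) *)
    complemented⊑~y* {b} {y} complemented b⊑y = *-greatest (⊑0⇒≈0 (begin
      (~ y) ∧ b           ≤⟨ ∧-greatest (⊑-trans (x∧y≤x _ _) (~-antitone b⊑y))
                                        (⊑-trans (x∧y≤y _ _) (⊑-trans (x⊑x** b) (x*⊑~x (b *)))) ⟩
      (~ b) ∧ (~ (b *))   ≈⟨ cover⇒~-disjoint complemented ⟩
      0#                  ∎))

  -- Under the Stone identity (~y)* is the greatest complemented element
  -- below y, so it is the same for any two Kleene negations.
  ~*-unique : StoneIdentity L 1# _* →
      ∀ (~₁ ~₂ : Carrier → Carrier) → IsPKA L ~₁ → IsPKA L ~₂ →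
      ∀ y → ((~₁ y) *) ≈ ((~₂ y) *)
  ~*-unique stone ~₁ ~₂ pka₁ pka₂ y = ⊑-antisym (below ~₁ ~₂ pka₁ pka₂) (below ~₂ ~₁ pka₂ pka₁)
    where
    -- (~y)* is complemented by the Stone identity and lies below y.
    below : ∀ (~ ~′ : Carrier → Carrier) → IsPKA L ~ → IsPKA L ~′ → ((~ y) *) ⊑ ((~′ y) *)
    below ~ ~′ pka pka′ =
      KleeneNegation.complemented⊑~y* ~′ pka′ (stone (~ y)) (KleeneNegation.~y*⊑y ~ pka y)

corollary4p4 : ∀ {c ℓ} (L : Lattice c ℓ) (0# 1# : Lattice.Carrier L)
    (_* : Lattice.Carrier L → Lattice.Carrier L)
    (~₁ ~₂ : Lattice.Carrier L → Lattice.Carrier L) →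
    IsBounded L 0# 1# →
    IsPseudocomplement L 0# _* →
    StoneIdentity L 1# _* →
    IsPKA L ~₁ → IsRegular L ~₁ _* →
    IsPKA L ~₂ → IsRegular L ~₂ _* →
    ∀ x → Lattice._≈_ L (~₁ x) (~₂ x)
corollary4p4 L 0# 1# _* ~₁ ~₂ bounded pseudocomplement stone pka₁ regular₁ pka₂ _ x =
  regular₁ (~₁ x) (~₂ x) (same* x) (begin
    (~₁ (~₁ x)) *   ≈⟨ *-cong (~₁-involutive x) ⟩
    x *             ≈⟨ *-cong (sym (~₂-involutive x)) ⟩
    (~₂ (~₂ x)) *   ≈⟨ sym (same* (~₂ x)) ⟩
    (~₁ (~₂ x)) *   ∎)
  where
  open Lattice L
  open BoundedPseudocomplemented L 0# 1# _* bounded pseudocomplement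
    using (*-cong; ~*-unique; module KleeneNegation)
  open SetoidReasoning setoid
  ~₁-involutive : ∀ y → (~₁ (~₁ y)) ≈ y
  ~₁-involutive = KleeneNegation.~~x≈x ~₁ pka₁
  ~₂-involutive : ∀ y → (~₂ (~₂ y)) ≈ y
  ~₂-involutive = KleeneNegation.~~x≈x ~₂ pka₂
  same* : ∀ y → ((~₁ y) *) ≈ ((~₂ y) *)
  same* = ~*-unique stone ~₁ ~₂ pka₁ pka₂
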